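{- Let $1\le k\le n$. (1) Let $Y$ be an $(n,k)$ right Gog trapezoid. Among all Gog triangles of size $n$ from which $Y$ can be extracted there is a smallest one for the entrywise order, and this smallest triangle $X$ satisfies $X_{i,j}=j$ for all $i\geqslant j+k$. (2) Let $Y$ be an $(n,k)$ left Gog trapezoid. Among all Gog triangles of size $n$ from which $Y$ can be extracted there is a smallest one for the entrywise order, and this smallest triangle $X$ satisfies, for all $n\ge i\ge j\geqslant k$, $$X_{i,j}=\max\bigl(X_{i,k}+j-k,\;X_{i-1,k}+j-k-1,\;\ldots,\;X_{i-j+k,k}\bigr).$$ Here $X_{i-r,k}$ denotes the entry of $Y$ at that position, and $X_{i-r,k}+j-k-r$ runs over $r=0,1,\ldots,j-k$.
   Context: A Gelfand-Tsetlin triangle of size $n$ is an array $X=(X_{i,j})_{n\ge i\ge j\ge 1}$ of positive integers with $X_{i+1,j}\le X_{i,j}\le X_{i+1,j+1}$ for $n-1\ge i\ge j\ge 1$. Row $i$ consists of $X_{i,1},\dots,X_{i,i}$, with row $n$ drawn on top and row $1$ (the single entry $X_{1,1}$) at the bottom. Triangles are ordered entrywise. A Gog triangle of size $n$ is a Gelfand-Tsetlin triangle with strictly increasing rows ($X_{i,j}<X_{i,j+1}$) and with top row $X_{n,j}=j$ for $1\le j\le n$. An $(n,k)$ right Gog trapezoid is the subarray $(X_{i,j})_{i-j\le k-1}$ of some Gog triangle $X$ of size $n$. These are the $k$ rightmost SW-NE diagonals. An $(n,k)$ left Gog trapezoid is the subarray $(X_{i,j})_{j\le k}$ of some Gog triangle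 of size $n$. These are the $k$ leftmost NW-SE diagonals. A trapezoid "can be extracted" from a triangle if it equals the corresponding subarray of that triangle. -}

module Defs where

open import Data.Nat using (ℕ; zero; suc; _+_; _∸_; _≤_; _<_; _⊔_)
open import Data.List using (List; foldr; map; upTo)
open import Data.Product using (Σ; _×_; _,_)
open import Relation.Binary.PropositionalEquality using (_≡_)

-- A triangular array is represented as a function on index pairs (i , j);
-- only the values at positions with 1 ≤ j ≤ i ≤ n are meaningful.
Array : Set
Array = ℕ → ℕ → ℕ

Pos : ℕ → ℕ → ℕ → Set
Pos n i j = (1 ≤ j) × (j ≤ i) × (i ≤ n)

IsGT : ℕ → Array → Set
IsGT n X =
  (∀ i j → Pos n i j → 1 ≤ X i j) ×
  (∀ i j → 1 ≤ j → j ≤ i → suc i ≤ n →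
      (X (suc i) j ≤ X i j) × (X i j ≤ X (suc i) (suc j)))

IsGog : ℕ → Array → Set
IsGog n X =
  IsGT n X ×
  (∀ i j → 1 ≤ j → suc j ≤ i → i ≤ n → X i j < X i (suc j)) ×
  (∀ j → 1 ≤ j → j ≤ n → X n j ≡ j)

RightPos : ℕ → ℕ → ℕ → ℕ → Set
RightPos n k i j = Pos n i j × (suc i ≤ j + k)

LeftPos : ℕ → ℕ → ℕ → ℕ → Set
LeftPos n k i j = Pos n i j × (j ≤ k)

ExtractOn : (ℕ → ℕ → Set) → Array → Array → Set
ExtractOn P X Y = ∀ i j → P i j → X i j ≡ Y i j

RightExtract : ℕ → ℕ → Array → Array → Set
RightExtract n k = ExtractOn (RightPos n k)

LeftExtract : ℕ → ℕ → Array → Array → Set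
LeftExtract n k = ExtractOn (LeftPos n k)

IsRightGogTrap : ℕ → ℕ → Array → Set
IsRightGogTrap n k Y = Σ Array λ X → IsGog n X × RightExtract n k X Y

IsLeftGogTrap : ℕ → ℕ → Array → Set
IsLeftGogTrap n k Y = Σ Array λ X → IsGog n X × LeftExtract n k X Y

_≤[_]_ : Array → ℕ → Array → Set
X ≤[ n ] Z = ∀ i j → Pos n i j → X i j ≤ Z i j

IsSmallestGog : ℕ → (Array → Array → Set) → Array → Array → Set
IsSmallestGog n E Y X =
  IsGog n X × E X Y × (∀ Z → IsGog n Z → E Z Y → X ≤[ n ] Z)

leftMax : Array → ℕ → ℕ → ℕ → ℕ
leftMax X k i j =
  foldr _⊔_ 0 (map (λ r → X (i ∸ r) k + ((j ∸ k) ∸ r)) (upTo (suc (j ∸ k))))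

module Submission where

-- The basic fact about a Gog triangle X is that entries dominate their
-- column index, j ≤ X i j, since rows are positive and strictly increasing.
--
-- Right trapezoids: keep Y on its k rightmost diagonals and put j
-- elsewhere.  The basic fact makes this a lower bound for every Gog
-- triangle containing Y, and a case analysis on the trapezoid boundary
-- shows that it is itself a Gog triangle.
--
-- Left trapezoids: keep Y on the columns j ≤ k and put, in column k + d,
-- the envelope  max_{0 ≤ r ≤ d} (X_{i-r,k} + d - r)  of column k.  Every
-- Gog triangle containing Y dominates the envelope (induction on d, using
-- row strictness and interlacing).  The envelope decreases going up
-- because column k does, increases along rows and interlaces by its
-- recursive shape, and its top row is forced: the domination applied to a
-- given Gog triangle bounds it above by the top row 1 … n.

open import Defs
open import Data.Nat using (ℕ; _+_; _≤_)
open import Data.Product using (Σ; _×_)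
open import Relation.Binary.PropositionalEquality using (_≡_)

open import Data.Nat using (zero; suc; _∸_; _<_; _⊔_; z≤n; s≤s; _≤?_)
open import Data.Nat.Properties
open import Data.Product using (_,_; proj₁; proj₂)
open import Data.Sum using (inj₁; inj₂)
open import Data.List using (foldr; map; upTo; applyUpTo)
open import Data.List.Properties using (map-upTo; map-cong)
open import Relation.Binary.PropositionalEquality using (refl; sym; trans; cong; module ≡-Reasoning)
open import Relation.Nullary using (yes; no; contradiction)
open import Function using (_∘_)

≤-by : ∀ {a b c d} → a ≡ c → b ≡ d → c ≤ d → a ≤ b
≤-by refl refl h = h

shrink : ∀ k d i → k + suc d ≤ suc i → k + d ≤ i
shrink k d i p = ≤-pred (≤-trans (≤-reflexive (sym (+-suc k d))) p)

module GogTriangle {n : ℕ} {X : Array} (gog : IsGog n X) where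

  positive : ∀ i j → Pos n i j → 1 ≤ X i j
  positive = proj₁ (proj₁ gog)

  interlaceˡ : ∀ i j → 1 ≤ j → j ≤ i → suc i ≤ n → X (suc i) j ≤ X i j
  interlaceˡ i j p q r = proj₁ (proj₂ (proj₁ gog) i j p q r)

  interlaceʳ : ∀ i j → 1 ≤ j → j ≤ i → suc i ≤ n → X i j ≤ X (suc i) (suc j)
  interlaceʳ i j p q r = proj₂ (proj₂ (proj₁ gog) i j p q r)

  row-increasing : ∀ i j → 1 ≤ j → suc j ≤ i → i ≤ n → X i j < X i (suc j)
  row-increasing = proj₁ (proj₂ gog)

  top-row : ∀ j → 1 ≤ j → j ≤ n → X n j ≡ j
  top-row = proj₂ (proj₂ gog)

  -- A positive strictly increasing row has j-th entry at least j.
  lower-bound : ∀ i j → Pos n i j → j ≤ X i j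
  lower-bound i (suc zero) P = positive i 1 P
  lower-bound i (suc (suc j)) (_ , q , r) =
    ≤-<-trans (lower-bound i (suc j) (s≤s z≤n , ≤-trans (n≤1+n _) q , r))
              (row-increasing i (suc j) (s≤s z≤n) q r)

rightFill : ℕ → Array → Array
rightFill k Y i j with suc i ≤? j + k
... | yes _ = Y i j
... | no _ = j

module RightFill (n k : ℕ) (Y : Array) where

  R : Array
  R = rightFill k Y

  fill-inside : ∀ i j → suc i ≤ j + k → R i j ≡ Y i j
  fill-inside i j p with suc i ≤? j + k
  ... | yes _ = refl
  ... | no ¬p = contradiction p ¬p

  fill-outside : ∀ i j → j + k ≤ i → R i j ≡ j
  fill-outside i j p with suc i ≤? j + k
  ... | yes q = contradiction (≤-trans q p) (<-irrefl refl)
  ... | no _ = refl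

  -- Every Gog triangle containing Y dominates R: on the trapezoid they
  -- agree, elsewhere R takes the least possible value j.
  fill-minimal : ∀ Z → IsGog n Z → RightExtract n k Z Y → R ≤[ n ] Z
  fill-minimal Z gZ extZ i j P with <-≤-connex i (j + k)
  ... | inj₁ s = ≤-reflexive (trans (fill-inside i j s) (sym (extZ i j (P , s))))
  ... | inj₂ s = ≤-by (fill-outside i j s) refl (GogTriangle.lower-bound gZ i j P)

  module _ (W : Array) (gW : IsGog n W) (extW : RightExtract n k W Y) where
    open GogTriangle gW

    fill-W : ∀ i j → Pos n i j → suc i ≤ j + k → R i j ≡ W i j
    fill-W i j P s = trans (fill-inside i j s) (sym (extW i j (P , s)))

    fill-lower : ∀ i j → Pos n i j → j ≤ R i j
    fill-lower i j P with <-≤-connex i (j + k)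
    ... | inj₁ s = ≤-by refl (fill-W i j P s) (lower-bound i j P)
    ... | inj₂ s = ≤-reflexive (sym (fill-outside i j s))

    fill-interlace : ∀ i j → 1 ≤ j → j ≤ i → suc i ≤ n →
      (R (suc i) j ≤ R i j) × (R i j ≤ R (suc i) (suc j))
    fill-interlace i j p q r = below , above
      where
      P : Pos n i j
      P = p , q , ≤-trans (n≤1+n i) r
      P↑ : Pos n (suc i) (suc j)
      P↑ = s≤s z≤n , s≤s q , r
      -- if (i+1, j) lies in the trapezoid, so does (i, j)
      below : R (suc i) j ≤ R i j
      below with <-≤-connex (suc i) (j + k)
      ... | inj₁ s = ≤-by (fill-W (suc i) j (p , ≤-trans q (n≤1+n i) , r) s)
                          (fill-W i j P (≤-trans (n≤1+n _) s)) (interlaceˡ i j p q r)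
      ... | inj₂ s = ≤-by (fill-outside (suc i) j s) refl (fill-lower i j P)
      -- if (i, j) lies in the trapezoid, so does (i+1, j+1)
      above : R i j ≤ R (suc i) (suc j)
      above with <-≤-connex i (j + k)
      ... | inj₁ s = ≤-by (fill-W i j P s) (fill-W (suc i) (suc j) P↑ (s≤s s))
                          (interlaceʳ i j p q r)
      ... | inj₂ s = ≤-by (fill-outside i j s) refl
                          (≤-trans (n≤1+n j) (fill-lower (suc i) (suc j) P↑))

    -- if (i, j) lies in the trapezoid, so does (i, j+1)
    fill-increasing : ∀ i j → 1 ≤ j → suc j ≤ i → i ≤ n → R i j < R i (suc j)
    fill-increasing i j p q r with <-≤-connex i (j + k)
    ... | inj₁ s = ≤-by (cong suc (fill-W i j (p , ≤-trans (n≤1+n j) q , r) s))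
                        (fill-W i (suc j) (s≤s z≤n , q , r) (≤-trans s (n≤1+n _)))
                        (row-increasing i j p q r)
    ... | inj₂ s = ≤-by (cong suc (fill-outside i j s)) refl
                        (fill-lower i (suc j) (s≤s z≤n , q , r))

    fill-top : ∀ j → 1 ≤ j → j ≤ n → R n j ≡ j
    fill-top j p q with <-≤-connex n (j + k)
    ... | inj₁ s = trans (fill-W n j (p , q , ≤-refl) s) (top-row j p q)
    ... | inj₂ s = fill-outside n j s

    fill-gog : IsGog n R
    fill-gog = ((λ i j P → ≤-trans (proj₁ P) (fill-lower i j P)) , fill-interlace)
             , fill-increasing , fill-top

-- envelope b d = max_{0 ≤ r ≤ d} (b r + (d - r)): the least value at
-- distance d to the right of a column whose entries going down are b 0, b 1, …
envelope : (ℕ → ℕ) → ℕ → ℕ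
envelope b zero = b 0
envelope b (suc d) = (b 0 + suc d) ⊔ envelope (b ∘ suc) d

envelope-head : ∀ b d → b 0 + d ≤ envelope b d
envelope-head b zero = ≤-reflexive (+-identityʳ (b 0))
envelope-head b (suc d) = m≤m⊔n _ _

envelope-tail : ∀ b d → envelope (b ∘ suc) d ≤ envelope b (suc d)
envelope-tail b d = m≤n⊔m _ _

envelope-increasing : ∀ b d → envelope b d < envelope b (suc d)
envelope-increasing b zero = ≤-trans (≤-reflexive (+-comm 1 (b 0))) (m≤m⊔n _ _)
envelope-increasing b (suc d) =
  ⊔-mono-≤ (≤-reflexive (sym (+-suc (b 0) (suc d)))) (envelope-increasing (b ∘ suc) d)

envelope-fold : ∀ b d → foldr _⊔_ 0 (applyUpTo (λ r → b r + (d ∸ r)) (suc d)) ≡ envelope b d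
envelope-fold b zero = trans (⊔-identityʳ _) (+-identityʳ (b 0))
envelope-fold b (suc d) = cong ((b 0 + suc d) ⊔_) (envelope-fold (b ∘ suc) d)

IsColumn : ℕ → ℕ → Array → (ℕ → ℕ) → Set
IsColumn n k X a = ∀ i → k ≤ i → i ≤ n → a i ≡ X i k

module ColumnEnvelope (n k : ℕ) (1≤k : 1 ≤ k) (a : ℕ → ℕ) where

  E : ℕ → ℕ → ℕ
  E i = envelope (λ r → a (i ∸ r))

  no-row-zero : ∀ {d} → k + suc d ≤ 0 → ∀ {ℓ} {A : Set ℓ} → A
  no-row-zero {d} p with m+n≤o⇒n≤o k {suc d} p
  ... | ()

  E-minimal : ∀ Z → IsGog n Z → IsColumn n k Z a →
    ∀ d i → k + d ≤ i → i ≤ n → E i d ≤ Z i (k + d)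
  E-minimal Z gZ col zero i p r =
    ≤-reflexive (trans (col i (≤-trans (m≤m+n k 0) p) r) (cong (Z i) (sym (+-identityʳ k))))
  E-minimal Z gZ col (suc d) zero p r = no-row-zero p
  E-minimal Z gZ col (suc d) (suc i) p r =
    ≤-by refl (cong (Z (suc i)) (+-suc k d)) (⊔-lub from-head from-tail)
    where
    open GogTriangle gZ
    p′ : k + d ≤ i
    p′ = shrink k d i p
    1≤k+d : 1 ≤ k + d
    1≤k+d = ≤-trans 1≤k (m≤m+n k d)
    -- the head term sits strictly left of Z (i+1) (k+d+1) in its row
    from-head : a (suc i) + suc d ≤ Z (suc i) (suc (k + d))
    from-head =
      ≤-by (+-suc (a (suc i)) d) refl
        (≤-<-trans (≤-trans (envelope-head _ d) (E-minimal Z gZ col d (suc i) (≤-trans p′ (n≤1+n i)) r))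
                   (row-increasing (suc i) (k + d) 1≤k+d (s≤s p′) r))
    -- the tail terms sit SW of Z (i+1) (k+d+1)
    from-tail : E i d ≤ Z (suc i) (suc (k + d))
    from-tail = ≤-trans (E-minimal Z gZ col d i p′ (≤-trans (n≤1+n i) r))
                        (interlaceʳ i (k + d) 1≤k+d p′ r)

  module _ (W : Array) (gW : IsGog n W) (col : IsColumn n k W a) where
    open GogTriangle gW

    -- Columns of a Gog triangle weakly decrease going up, hence so does E.
    E-decreasing : ∀ d i → k + d ≤ i → suc i ≤ n → E (suc i) d ≤ E i d
    E-decreasing zero i p r =
      ≤-by (col (suc i) (≤-trans k≤i (n≤1+n i)) r) (col i k≤i (≤-trans (n≤1+n i) r))
           (interlaceˡ i k 1≤k k≤i r)
      where
      k≤i : k ≤ i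
      k≤i = ≤-trans (m≤m+n k 0) p
    E-decreasing (suc d) zero p r = no-row-zero p
    E-decreasing (suc d) (suc i) p r =
      ⊔-mono-≤ (+-monoˡ-≤ (suc d) (E-decreasing zero (suc i) (≤-trans (+-monoʳ-≤ k z≤n) p) r))
               (E-decreasing d i (shrink k d i p) (≤-trans (n≤1+n _) r))

    E-top : ∀ d → k + d ≤ n → E n d ≡ k + d
    E-top d p = ≤-antisym
      (≤-by refl (sym (top-row (k + d) (≤-trans 1≤k (m≤m+n k d)) p)) (E-minimal W gW col d n p ≤-refl))
      (≤-by (cong (_+ d) (sym (trans (col n kn ≤-refl) (top-row k 1≤k kn)))) refl (envelope-head _ d))
      where
      kn : k ≤ n
      kn = ≤-trans (m≤m+n k d) p

leftFill : ℕ → Array → Array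
leftFill k Y i j with j ≤? k
... | yes _ = Y i j
... | no _ = envelope (λ r → Y (i ∸ r) k) (j ∸ k)

module LeftFill (n k : ℕ) (1≤k : 1 ≤ k) (Y : Array) where

  L : Array
  L = leftFill k Y

  open ColumnEnvelope n k 1≤k (λ i → Y i k)

  fill-inside : ∀ i j → j ≤ k → L i j ≡ Y i j
  fill-inside i j p with j ≤? k
  ... | yes _ = refl
  ... | no ¬p = contradiction p ¬p

  fill-envelope : ∀ i j → k ≤ j → L i j ≡ E i (j ∸ k)
  fill-envelope i j k≤j with j ≤? k
  ... | no _ = refl
  ... | yes j≤k with ≤-antisym j≤k k≤j
  ...   | refl = cong (E i) (sym (n∸n≡0 k))

  extract-column : ∀ Z → LeftExtract n k Z Y → IsColumn n k Z (λ i → Y i k)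
  extract-column Z extZ i p r = sym (extZ i k ((1≤k , p , r) , ≤-refl))

  fill-minimal : ∀ Z → IsGog n Z → LeftExtract n k Z Y → L ≤[ n ] Z
  fill-minimal Z gZ extZ i j P@(_ , q , r) with <-≤-connex j k
  ... | inj₁ j<k = ≤-reflexive (trans (fill-inside i j (<⇒≤ j<k)) (sym (extZ i j (P , <⇒≤ j<k))))
  ... | inj₂ k≤j =
    ≤-by (fill-envelope i j k≤j) (cong (Z i) (sym (m+[n∸m]≡n k≤j)))
         (E-minimal Z gZ (extract-column Z extZ) (j ∸ k) i (≤-by (m+[n∸m]≡n k≤j) refl q) r)

  fill-leftMax : ∀ i j → k ≤ j → L i j ≡ leftMax L k i j
  fill-leftMax i j k≤j = begin
    L i j                                                          ≡⟨ fill-envelope i j k≤j ⟩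
    E i d                                                          ≡⟨ envelope-fold _ d ⟨
    foldr _⊔_ 0 (applyUpTo (λ r → Y (i ∸ r) k + (d ∸ r)) (suc d))  ≡⟨ cong (foldr _⊔_ 0) (map-upTo _ (suc d)) ⟨
    foldr _⊔_ 0 (map (λ r → Y (i ∸ r) k + (d ∸ r)) (upTo (suc d))) ≡⟨ cong (foldr _⊔_ 0) column-k ⟨
    leftMax L k i j                                                ∎
    where
    open ≡-Reasoning
    d : ℕ
    d = j ∸ k
    column-k : map (λ r → L (i ∸ r) k + (d ∸ r)) (upTo (suc d))
             ≡ map (λ r → Y (i ∸ r) k + (d ∸ r)) (upTo (suc d))
    column-k = map-cong (λ r → cong (_+ (d ∸ r)) (fill-inside (i ∸ r) k ≤-refl)) (upTo (suc d))

  module _ (W : Array) (gW : IsGog n W) (extW : LeftExtract n k W Y) where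
    open GogTriangle gW
    private
      col : IsColumn n k W (λ i → Y i k)
      col = extract-column W extW

    fill-W : ∀ i j → Pos n i j → j ≤ k → L i j ≡ W i j
    fill-W i j P s = trans (fill-inside i j s) (sym (extW i j (P , s)))

    fill-positive : ∀ i j → Pos n i j → 1 ≤ L i j
    fill-positive i j P@(_ , q , r) with <-≤-connex j k
    ... | inj₁ j<k = ≤-by refl (fill-W i j P (<⇒≤ j<k)) (positive i j P)
    ... | inj₂ k≤j =
      ≤-by refl (fill-envelope i j k≤j)
        (≤-trans (≤-by refl (col i k≤i r) (positive i k (1≤k , k≤i , r)))
                 (≤-trans (m≤m+n _ (j ∸ k)) (envelope-head _ (j ∸ k))))
      where
      k≤i : k ≤ i
      k≤i = ≤-trans k≤j q

    fill-interlace : ∀ i j → 1 ≤ j → j ≤ i → suc i ≤ n →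
      (L (suc i) j ≤ L i j) × (L i j ≤ L (suc i) (suc j))
    fill-interlace i j p q r with <-≤-connex j k
    ... | inj₁ j<k =
      ≤-by (fill-W (suc i) j (p , ≤-trans q (n≤1+n i) , r) (<⇒≤ j<k)) (fill-W i j P (<⇒≤ j<k))
           (interlaceˡ i j p q r) ,
      ≤-by (fill-W i j P (<⇒≤ j<k)) (fill-W (suc i) (suc j) (s≤s z≤n , s≤s q , r) j<k)
           (interlaceʳ i j p q r)
      where
      P : Pos n i j
      P = p , q , ≤-trans (n≤1+n i) r
    ... | inj₂ k≤j =
      ≤-by (fill-envelope (suc i) j k≤j) (fill-envelope i j k≤j)
           (E-decreasing W gW col (j ∸ k) i (≤-by (m+[n∸m]≡n k≤j) refl q) r) ,
      ≤-by (fill-envelope i j k≤j) (trans (fill-envelope (suc i) (suc j) (≤-trans k≤j (n≤1+n j)))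
                                          (cong (E (suc i)) (+-∸-assoc 1 k≤j)))
           (envelope-tail (λ r → Y (suc i ∸ r) k) (j ∸ k))

    fill-increasing : ∀ i j → 1 ≤ j → suc j ≤ i → i ≤ n → L i j < L i (suc j)
    fill-increasing i j p q r with <-≤-connex j k
    ... | inj₁ j<k = ≤-by (cong suc (fill-W i j (p , ≤-trans (n≤1+n j) q , r) (<⇒≤ j<k)))
                          (fill-W i (suc j) (s≤s z≤n , q , r) j<k) (row-increasing i j p q r)
    ... | inj₂ k≤j =
      ≤-by (cong suc (fill-envelope i j k≤j))
           (trans (fill-envelope i (suc j) (≤-trans k≤j (n≤1+n j))) (cong (E i) (+-∸-assoc 1 k≤j)))
           (envelope-increasing _ (j ∸ k))

    fill-top : ∀ j → 1 ≤ j → j ≤ n → L n j ≡ j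
    fill-top j p q with <-≤-connex j k
    ... | inj₁ j<k = trans (fill-W n j (p , q , ≤-refl) (<⇒≤ j<k)) (top-row j p q)
    ... | inj₂ k≤j =
      trans (fill-envelope n j k≤j)
            (trans (E-top W gW col (j ∸ k) (≤-by (m+[n∸m]≡n k≤j) refl q)) (m+[n∸m]≡n k≤j))

    fill-gog : IsGog n L
    fill-gog = (fill-positive , fill-interlace) , fill-increasing , fill-top

mainTheorem1 : (n k : ℕ) → 1 ≤ k → k ≤ n →
    ((Y : Array) → IsRightGogTrap n k Y →
      Σ Array λ X → IsSmallestGog n (RightExtract n k) Y X ×
        (∀ i j → Pos n i j → j + k ≤ i → X i j ≡ j))
    ×
    ((Y : Array) → IsLeftGogTrap n k Y →
      Σ Array λ X → IsSmallestGog n (LeftExtract n k) Y X ×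
        (∀ i j → Pos n i j → k ≤ j → X i j ≡ leftMax X k i j))
mainTheorem1 n k 1≤k _ = right , left
  where
  right : (Y : Array) → IsRightGogTrap n k Y →
    Σ Array λ X → IsSmallestGog n (RightExtract n k) Y X ×
      (∀ i j → Pos n i j → j + k ≤ i → X i j ≡ j)
  right Y (W , gW , extW) =
    R , (fill-gog W gW extW , (λ i j P → fill-inside i j (proj₂ P)) , fill-minimal) ,
    (λ i j _ → fill-outside i j)
    where open RightFill n k Y

  left : (Y : Array) → IsLeftGogTrap n k Y →
    Σ Array λ X → IsSmallestGog n (LeftExtract n k) Y X ×
      (∀ i j → Pos n i j → k ≤ j → X i j ≡ leftMax X k i j)
  left Y (W , gW , extW) =
    L , (fill-gog W gW extW , (λ i j P → fill-inside i j (proj₂ P)) , fill-minimal) ,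
    (λ i j _ → fill-leftMax i j)
    where open LeftFill n k 1≤k Y
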